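{- Let $\mathbf{C}$ be a category with finite coproducts. Every complete Elgot monad on $\mathbf{C}$ is a weak complete Elgot monad.
   Context: Monads are Kleisli triples $(T,\eta,(-)^*)$ with $Tf=(\eta\circ f)^*$. A complete Elgot monad is a monad with an operator assigning to each $f:X\to T(Y+X)$ a morphism $f^\dagger:X\to TY$ such that: (fixpoint) $f^\dagger=[\eta_Y,f^\dagger]^*\circ f$; (naturality) for $g:Y\to TZ$, $g^*\circ f^\dagger=([T\mathsf{inl}\circ g,\eta_{Z+X}\circ\mathsf{inr}]^*\circ f)^\dagger$; (codiagonal) for $g:X\to T((Y+X)+X)$, $(T[\mathrm{id}_{Y+X},\mathsf{inr}]\circ g)^\dagger=(g^\dagger)^\dagger$; (uniformity) for $f:X\to T(Y+X)$, $g:Z\to T(Y+Z)$, $h:Z\to X$, if $f\circ h=T(\mathrm{id}_Y+h)\circ g$ then $f^\dagger\circ h=g^\dagger$. A weak complete Elgot monad is a monad with such an operator satisfying fixpoint, naturality and uniformity, and moreover: for all $g:X\to T(Y+X)$ and $f:Y\to T(Z+Y)$, letting $w=[T(\mathrm{id}_Z+\mathsf{inl})\circ f,\ \eta\circ\mathsf{inr}\circ\mathsf{inr}]^*\circ[\eta\circ\mathsf{inl},g]:Y+X\to T(Z+(Y+X))$ (with $\mathsf{inl}:Y\to Y+X$ and $\mathsf{inr}\circ\mathsf{inr}:X\to Z+(Y+X)$), one has $w^\dagger\circ\mathsf{inr}=(f^\dagger)^*\circ g^\dagger:X\to TZ$. -}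

module Defs where

open import Level using (Level; _⊔_; suc)
open import Relation.Binary.Bundles using (Setoid)
open import Relation.Binary.Structures using (IsEquivalence)

record Category (o m e : Level) : Set (suc (o ⊔ m ⊔ e)) where
  infixr 9 _∘_
  infix  4 _≈_
  infix  5 _⇒_
  field
    Obj    : Set o
    _⇒_    : Obj → Obj → Set m
    _≈_    : ∀ {A B} → A ⇒ B → A ⇒ B → Set e
    id     : ∀ {A} → A ⇒ A
    _∘_    : ∀ {A B C} → B ⇒ C → A ⇒ B → A ⇒ C
    ≈-equiv  : ∀ {A B} → IsEquivalence (_≈_ {A} {B})
    ∘-resp-≈ : ∀ {A B C} {f h : B ⇒ C} {g i : A ⇒ B} → f ≈ h → g ≈ i → f ∘ g ≈ h ∘ i
    assoc    : ∀ {A B C D} {f : A ⇒ B} {g : B ⇒ C} {h : C ⇒ D} → (h ∘ g) ∘ f ≈ h ∘ (g ∘ f)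
    identityˡ : ∀ {A B} {f : A ⇒ B} → id ∘ f ≈ f
    identityʳ : ∀ {A B} {f : A ⇒ B} → f ∘ id ≈ f

-- Chosen binary coproducts (finite coproducts; the initial object is not
-- needed by the statement but is included for faithfulness).
record FiniteCoproducts {o m e} (C : Category o m e) : Set (o ⊔ m ⊔ e) where
  open Category C
  infixr 7 _+_
  field
    ⊥       : Obj
    ¡       : ∀ {A} → ⊥ ⇒ A
    ¡-unique : ∀ {A} (f : ⊥ ⇒ A) → ¡ ≈ f
    _+_     : Obj → Obj → Obj
    inl     : ∀ {A B} → A ⇒ A + B
    inr     : ∀ {A B} → B ⇒ A + B
    [_,_]   : ∀ {A B X} → A ⇒ X → B ⇒ X → A + B ⇒ X
    inl-β   : ∀ {A B X} {f : A ⇒ X} {g : B ⇒ X} → [ f , g ] ∘ inl ≈ f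
    inr-β   : ∀ {A B X} {f : A ⇒ X} {g : B ⇒ X} → [ f , g ] ∘ inr ≈ g
    +-unique : ∀ {A B X} {f : A ⇒ X} {g : B ⇒ X} {h : A + B ⇒ X} →
               h ∘ inl ≈ f → h ∘ inr ≈ g → [ f , g ] ≈ h

  _⊕_ : ∀ {A A' B B'} → A ⇒ A' → B ⇒ B' → A + B ⇒ A' + B'
  f ⊕ g = [ inl ∘ f , inr ∘ g ]

record KleisliTriple {o m e} (C : Category o m e) : Set (o ⊔ m ⊔ e) where
  open Category C
  field
    T     : Obj → Obj
    η     : ∀ {A} → A ⇒ T A
    _*    : ∀ {A B} → A ⇒ T B → T A ⇒ T B
    *-resp-≈ : ∀ {A B} {f g : A ⇒ T B} → f ≈ g → f * ≈ g *
    η*    : ∀ {A} → η {A} * ≈ id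
    *η    : ∀ {A B} {f : A ⇒ T B} → f * ∘ η ≈ f
    **    : ∀ {A B D} {f : A ⇒ T B} {g : B ⇒ T D} → (g * ∘ f) * ≈ g * ∘ f *

  Tmap : ∀ {A B} → A ⇒ B → T A ⇒ T B
  Tmap f = (η ∘ f) *

module _ {o m e} {C : Category o m e} (CP : FiniteCoproducts C) (M : KleisliTriple C) where
  open Category C
  open FiniteCoproducts CP
  open KleisliTriple M

  record IterationOperator : Set (o ⊔ m ⊔ e) where
    field
      _†      : ∀ {X Y} → X ⇒ T (Y + X) → X ⇒ T Y
      †-resp-≈ : ∀ {X Y} {f g : X ⇒ T (Y + X)} → f ≈ g → f † ≈ g †

  module _ (It : IterationOperator) where
    open IterationOperator It

    Fixpoint : Set (o ⊔ m ⊔ e)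
    Fixpoint = ∀ {X Y} (f : X ⇒ T (Y + X)) → f † ≈ [ η , f † ] * ∘ f

    Naturality : Set (o ⊔ m ⊔ e)
    Naturality = ∀ {X Y Z} (f : X ⇒ T (Y + X)) (g : Y ⇒ T Z) →
      g * ∘ f † ≈ ([ Tmap inl ∘ g , η {Z + X} ∘ inr ] * ∘ f) †

    Codiagonal : Set (o ⊔ m ⊔ e)
    Codiagonal = ∀ {X Y} (g : X ⇒ T ((Y + X) + X)) →
      (Tmap [ id {Y + X} , inr ] ∘ g) † ≈ (g †) †

    Uniformity : Set (o ⊔ m ⊔ e)
    Uniformity = ∀ {X Y Z} (f : X ⇒ T (Y + X)) (g : Z ⇒ T (Y + Z)) (h : Z ⇒ X) →
      f ∘ h ≈ Tmap (id {Y} ⊕ h) ∘ g → f † ∘ h ≈ g †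

    WeakCodiagonal : Set (o ⊔ m ⊔ e)
    WeakCodiagonal = ∀ {X Y Z} (g : X ⇒ T (Y + X)) (f : Y ⇒ T (Z + Y)) →
      let w : Y + X ⇒ T (Z + (Y + X))
          w = [ Tmap (id {Z} ⊕ inl {Y} {X}) ∘ f , η ∘ inr {Z} ∘ inr {Y} {X} ] * ∘ [ η ∘ inl , g ]
      in (w †) ∘ inr ≈ (f †) * ∘ g †

  record IsCompleteElgot (It : IterationOperator) : Set (o ⊔ m ⊔ e) where
    field
      fixpoint   : Fixpoint It
      naturality : Naturality It
      codiagonal : Codiagonal It
      uniformity : Uniformity It

  record IsWeakCompleteElgot (It : IterationOperator) : Set (o ⊔ m ⊔ e) where
    field
      fixpoint       : Fixpoint It
      naturality     : Naturality It
      uniformity     : Uniformity It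
      weakCodiagonal : WeakCodiagonal It

-- The weak codiagonal law is an instance of the codiagonal law. Tag the
-- outcomes of the combined loop w on Y + X in two levels: iterations of f stay
-- in the inner loop, while leaving g is an outer-loop step. This gives
-- G : Y + X → T((Z + (Y + X)) + (Y + X)) with w = T[id, inr] ∘ G, so
-- w† = (G†)† by codiagonality. Inside G† only f is iterated, so by uniformity
-- and naturality G† ∘ inr = T(id + inr) ∘ k with k = [T inl ∘ f†, η ∘ inr]* ∘ g.
-- Uniformity then gives (G†)† ∘ inr = k†, which is (f†)* ∘ g† by naturality.
module Submission where

open import Level using (Level)
open import Relation.Binary.Bundles using (Setoid)
import Relation.Binary.Reasoning.Setoid as SetoidReasoning
open import Defs

module HomReasoning {o m e} (C : Category o m e) where
  open Category C

  hom-setoid : Obj → Obj → Setoid m e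
  hom-setoid A B = record { Carrier = A ⇒ B ; _≈_ = _≈_ ; isEquivalence = ≈-equiv }

  module _ {A B : Obj} where
    open Setoid (hom-setoid A B) public using (refl; sym; trans)
    open SetoidReasoning (hom-setoid A B) public

  ∘-resp-≈ˡ : ∀ {A B D} {f h : B ⇒ D} {g : A ⇒ B} → f ≈ h → f ∘ g ≈ h ∘ g
  ∘-resp-≈ˡ p = ∘-resp-≈ p refl

  ∘-resp-≈ʳ : ∀ {A B D} {f : B ⇒ D} {g h : A ⇒ B} → g ≈ h → f ∘ g ≈ f ∘ h
  ∘-resp-≈ʳ p = ∘-resp-≈ refl p

module CoproductProperties {o m e} {C : Category o m e} (CP : FiniteCoproducts C) where
  open Category C
  open FiniteCoproducts CP
  open HomReasoning C

  ∘-distribˡ-[] : ∀ {A B D E} {h : D ⇒ E} {a : A ⇒ D} {b : B ⇒ D} →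
                  h ∘ [ a , b ] ≈ [ h ∘ a , h ∘ b ]
  ∘-distribˡ-[] = sym (+-unique (trans assoc (∘-resp-≈ʳ inl-β)) (trans assoc (∘-resp-≈ʳ inr-β)))

  []-cong₂ : ∀ {A B D} {a c : A ⇒ D} {b d : B ⇒ D} → a ≈ c → b ≈ d → [ a , b ] ≈ [ c , d ]
  []-cong₂ p q = +-unique (trans inl-β (sym p)) (trans inr-β (sym q))

  []∘⊕ : ∀ {A B A' B' D} {a : A' ⇒ D} {b : B' ⇒ D} {c : A ⇒ A'} {d : B ⇒ B'} →
         [ a , b ] ∘ (c ⊕ d) ≈ [ a ∘ c , b ∘ d ]
  []∘⊕ = trans ∘-distribˡ-[]
    ([]-cong₂ (trans (sym assoc) (∘-resp-≈ˡ inl-β)) (trans (sym assoc) (∘-resp-≈ˡ inr-β)))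

  ⊕∘⊕ : ∀ {A B A' B' A'' B''} {a : A' ⇒ A''} {b : B' ⇒ B''} {c : A ⇒ A'} {d : B ⇒ B'} →
        (a ⊕ b) ∘ (c ⊕ d) ≈ (a ∘ c) ⊕ (b ∘ d)
  ⊕∘⊕ = trans []∘⊕ ([]-cong₂ assoc assoc)

  ⊕-cong₂ : ∀ {A B A' B'} {a c : A ⇒ A'} {b d : B ⇒ B'} → a ≈ c → b ≈ d → a ⊕ b ≈ c ⊕ d
  ⊕-cong₂ p q = []-cong₂ (∘-resp-≈ʳ p) (∘-resp-≈ʳ q)

module KleisliProperties {o m e} {C : Category o m e} (M : KleisliTriple C) where
  open Category C
  open KleisliTriple M
  open HomReasoning C

  Tmap-cong : ∀ {A B} {a b : A ⇒ B} → a ≈ b → Tmap a ≈ Tmap b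
  Tmap-cong p = *-resp-≈ (∘-resp-≈ʳ p)

  *∘η∘ : ∀ {A B D} {g : B ⇒ T D} {h : A ⇒ B} → g * ∘ (η ∘ h) ≈ g ∘ h
  *∘η∘ = trans (sym assoc) (∘-resp-≈ˡ *η)

  *∘Tmap : ∀ {A B D} {g : B ⇒ T D} {h : A ⇒ B} → g * ∘ Tmap h ≈ (g ∘ h) *
  *∘Tmap = trans (sym **) (*-resp-≈ *∘η∘)

  Tmap∘* : ∀ {A B D} {g : A ⇒ T B} {h : B ⇒ D} → Tmap h ∘ g * ≈ (Tmap h ∘ g) *
  Tmap∘* = sym **

  Tmap-∘ : ∀ {A B D} {a : B ⇒ D} {b : A ⇒ B} → Tmap a ∘ Tmap b ≈ Tmap (a ∘ b)
  Tmap-∘ = trans *∘Tmap (*-resp-≈ assoc)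

  Tmap∘η∘ : ∀ {A B D} {h : B ⇒ D} {k : A ⇒ B} → Tmap h ∘ (η ∘ k) ≈ η ∘ (h ∘ k)
  Tmap∘η∘ = trans *∘η∘ assoc

module CompleteElgotProperties {o m e} {C : Category o m e} {CP : FiniteCoproducts C}
    {M : KleisliTriple C} {It : IterationOperator CP M} (E : IsCompleteElgot CP M It) where
  open Category C
  open FiniteCoproducts CP
  open KleisliTriple M
  open IterationOperator It
  open IsCompleteElgot E
  open HomReasoning C
  open CoproductProperties CP
  open KleisliProperties M

  *∘†-unfold : ∀ {X Y Z} {f : X ⇒ T (Y + X)} {g : Y ⇒ T Z} →
               g * ∘ f † ≈ [ g , g * ∘ f † ] * ∘ f
  *∘†-unfold {f = f} {g} = begin
    g * ∘ f †                      ≈⟨ ∘-resp-≈ʳ (fixpoint f) ⟩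
    g * ∘ ([ η , f † ] * ∘ f)      ≈⟨ assoc ⟨
    (g * ∘ [ η , f † ] *) ∘ f      ≈⟨ ∘-resp-≈ˡ ** ⟨
    (g * ∘ [ η , f † ]) * ∘ f      ≈⟨ ∘-resp-≈ˡ (*-resp-≈ (trans ∘-distribˡ-[] ([]-cong₂ *η refl))) ⟩
    [ g , g * ∘ f † ] * ∘ f        ∎

  Tmap∘† : ∀ {X Y W} {f : X ⇒ T (Y + X)} {h : Y ⇒ W} →
           Tmap h ∘ f † ≈ (Tmap (h ⊕ id) ∘ f) †
  Tmap∘† {f = f} {h} = trans (naturality f (η ∘ h)) (†-resp-≈ (∘-resp-≈ˡ (*-resp-≈ η∘⊕)))
    where
    η∘⊕ : [ Tmap inl ∘ (η ∘ h) , η ∘ inr ] ≈ η ∘ (h ⊕ id)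
    η∘⊕ = trans ([]-cong₂ Tmap∘η∘ (∘-resp-≈ʳ (sym identityʳ))) (sym ∘-distribˡ-[])

  module WeakCodiagonalProof {X Y Z} (g : X ⇒ T (Y + X)) (f : Y ⇒ T (Z + Y)) where
    step : Y + X ⇒ T (Z + (Y + X))
    step = [ Tmap (id {Z} ⊕ inl {Y} {X}) ∘ f , η ∘ inr {Z} ∘ inr {Y} {X} ]

    w : Y + X ⇒ T (Z + (Y + X))
    w = step * ∘ [ η ∘ inl , g ]

    twoLevelStep : Y + X ⇒ T ((Z + (Y + X)) + (Y + X))
    twoLevelStep = [ Tmap (inl ⊕ inl) ∘ f , η ∘ inl ∘ inr ∘ inr ]

    twoLevel : Y + X ⇒ T ((Z + (Y + X)) + (Y + X))
    twoLevel = twoLevelStep * ∘ [ η ∘ inl , g ]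

    outerLoop : X ⇒ T (Z + X)
    outerLoop = [ Tmap inl ∘ f † , η ∘ inr ] * ∘ g

    collapse-twoLevelStep : Tmap [ id , inr ] ∘ twoLevelStep ≈ step
    collapse-twoLevelStep = trans ∘-distribˡ-[] ([]-cong₂ on-f on-g)
      where
      on-f : Tmap [ id , inr ] ∘ (Tmap (inl ⊕ inl) ∘ f) ≈ Tmap (id ⊕ inl) ∘ f
      on-f = trans (sym assoc)
        (∘-resp-≈ˡ (trans Tmap-∘ (Tmap-cong (trans []∘⊕ ([]-cong₂ (trans identityˡ (sym identityʳ)) refl)))))
      on-g : Tmap [ id , inr ] ∘ (η ∘ inl ∘ inr ∘ inr) ≈ η ∘ inr ∘ inr
      on-g = trans Tmap∘η∘ (∘-resp-≈ʳ (trans (sym assoc) (trans (∘-resp-≈ˡ inl-β) identityˡ)))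

    w≈collapse-twoLevel : w ≈ Tmap [ id , inr ] ∘ twoLevel
    w≈collapse-twoLevel = begin
      step * ∘ [ η ∘ inl , g ]                                  ≈⟨ ∘-resp-≈ˡ (*-resp-≈ collapse-twoLevelStep) ⟨
      (Tmap [ id , inr ] ∘ twoLevelStep) * ∘ [ η ∘ inl , g ]    ≈⟨ ∘-resp-≈ˡ Tmap∘* ⟨
      (Tmap [ id , inr ] ∘ twoLevelStep *) ∘ [ η ∘ inl , g ]    ≈⟨ assoc ⟩
      Tmap [ id , inr ] ∘ twoLevel                              ∎

    twoLevel†∘inl : twoLevel † ∘ inl ≈ Tmap inl ∘ f †
    twoLevel†∘inl = trans (uniformity twoLevel (Tmap (inl ⊕ id) ∘ f) inl on-Y) (sym Tmap∘†)
      where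
      on-Y : twoLevel ∘ inl ≈ Tmap (id ⊕ inl) ∘ (Tmap (inl ⊕ id) ∘ f)
      on-Y = begin
        twoLevel ∘ inl                              ≈⟨ trans assoc (∘-resp-≈ʳ inl-β) ⟩
        twoLevelStep * ∘ (η ∘ inl)                  ≈⟨ trans *∘η∘ inl-β ⟩
        Tmap (inl ⊕ inl) ∘ f                        ≈⟨ ∘-resp-≈ˡ (Tmap-cong (⊕-cong₂ identityˡ identityʳ)) ⟨
        Tmap ((id ∘ inl) ⊕ (inl ∘ id)) ∘ f          ≈⟨ ∘-resp-≈ˡ (trans Tmap-∘ (Tmap-cong ⊕∘⊕)) ⟨
        (Tmap (id ⊕ inl) ∘ Tmap (inl ⊕ id)) ∘ f     ≈⟨ assoc ⟩
        Tmap (id ⊕ inl) ∘ (Tmap (inl ⊕ id) ∘ f)     ∎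

    twoLevel†-unfold : [ η , twoLevel † ] * ∘ twoLevelStep ≈ Tmap (id ⊕ inr) ∘ [ Tmap inl ∘ f † , η ∘ inr ]
    twoLevel†-unfold = begin
      [ η , twoLevel † ] * ∘ twoLevelStep
        ≈⟨ trans ∘-distribˡ-[] ([]-cong₂ on-f on-g) ⟩
      [ [ η ∘ inl , Tmap inl ∘ f † ] * ∘ f , η ∘ inr ∘ inr ]
        ≈⟨ trans ∘-distribˡ-[] ([]-cong₂ exit-f exit-g) ⟨
      Tmap (id ⊕ inr) ∘ [ Tmap inl ∘ f † , η ∘ inr ] ∎
      where
      on-f : [ η , twoLevel † ] * ∘ (Tmap (inl ⊕ inl) ∘ f) ≈ [ η ∘ inl , Tmap inl ∘ f † ] * ∘ f
      on-f = trans (sym assoc) (∘-resp-≈ˡ (trans *∘Tmap (*-resp-≈ (trans []∘⊕ ([]-cong₂ refl twoLevel†∘inl)))))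
      on-g : [ η , twoLevel † ] * ∘ (η ∘ inl ∘ inr ∘ inr) ≈ η ∘ inr ∘ inr
      on-g = trans *∘η∘ (trans (sym assoc) (∘-resp-≈ˡ inl-β))
      exit-f : Tmap (id ⊕ inr) ∘ (Tmap inl ∘ f †) ≈ [ η ∘ inl , Tmap inl ∘ f † ] * ∘ f
      exit-f = trans (sym assoc) (trans (∘-resp-≈ˡ (trans Tmap-∘ (Tmap-cong (trans inl-β identityʳ)))) *∘†-unfold)
      exit-g : Tmap (id ⊕ inr) ∘ (η ∘ inr) ≈ η ∘ inr ∘ inr
      exit-g = trans Tmap∘η∘ (∘-resp-≈ʳ inr-β)

    twoLevel†∘inr : twoLevel † ∘ inr ≈ Tmap (id ⊕ inr) ∘ outerLoop
    twoLevel†∘inr = begin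
      twoLevel † ∘ inr                                              ≈⟨ ∘-resp-≈ˡ (fixpoint twoLevel) ⟩
      ([ η , twoLevel † ] * ∘ twoLevel) ∘ inr                       ≈⟨ trans assoc (∘-resp-≈ʳ (trans assoc (∘-resp-≈ʳ inr-β))) ⟩
      [ η , twoLevel † ] * ∘ (twoLevelStep * ∘ g)                   ≈⟨ trans (sym assoc) (∘-resp-≈ˡ (sym **)) ⟩
      ([ η , twoLevel † ] * ∘ twoLevelStep) * ∘ g                   ≈⟨ ∘-resp-≈ˡ (*-resp-≈ twoLevel†-unfold) ⟩
      (Tmap (id ⊕ inr) ∘ [ Tmap inl ∘ f † , η ∘ inr ]) * ∘ g        ≈⟨ trans (∘-resp-≈ˡ (sym Tmap∘*)) assoc ⟩
      Tmap (id ⊕ inr) ∘ outerLoop                                   ∎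

    weakCodiagonal : w † ∘ inr ≈ f † * ∘ g †
    weakCodiagonal = begin
      w † ∘ inr                               ≈⟨ ∘-resp-≈ˡ (†-resp-≈ w≈collapse-twoLevel) ⟩
      (Tmap [ id , inr ] ∘ twoLevel) † ∘ inr  ≈⟨ ∘-resp-≈ˡ (codiagonal twoLevel) ⟩
      twoLevel † † ∘ inr                      ≈⟨ uniformity (twoLevel †) outerLoop inr twoLevel†∘inr ⟩
      outerLoop †                             ≈⟨ naturality g (f †) ⟨
      f † * ∘ g †                             ∎

proposition5p3 : ∀ {o m e : Level} (C : Category o m e) (CP : FiniteCoproducts C)
                   (M : KleisliTriple C) (It : IterationOperator CP M) →
                   IsCompleteElgot CP M It → IsWeakCompleteElgot CP M It
proposition5p3 C CP M It E = record
  { fixpoint       = fixpoint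
  ; naturality     = naturality
  ; uniformity     = uniformity
  ; weakCodiagonal = WeakCodiagonalProof.weakCodiagonal
  }
  where
  open IsCompleteElgot E
  open CompleteElgotProperties E
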